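{- Let $\mathcal S\in\Sigma^n$ be a string and $\pi:[n]\to[n]$ a permutation that is order-preserving for $\mathcal S$. Then for every $i\in[2,n]$ it holds that $\mathrm{LPF}_\pi[i]\ge \mathrm{LPF}_\pi[i-1]-1$. In particular, the sequence $i+\mathrm{LPF}_\pi[i]$, for $i=1,\dots,n$, is nondecreasing.
   Context: Strings are 1-indexed, $\mathcal S[i,j]=\mathcal S[i]\cdots\mathcal S[j]$. For $i\neq j$, $\mathrm{rlce}(i,j)$ is the length of the longest common prefix of $\mathcal S[i,n]$ and $\mathcal S[j,n]$. A permutation $\pi:[n]\to[n]$ is order-preserving for $\mathcal S$ if for all $i,j\in[n-1]$, $\pi(i)<\pi(j)$ and $\mathcal S[i,i+1]=\mathcal S[j,j+1]$ imply $\pi(i+1)<\pi(j+1)$. The generalized longest previous factor array is defined by $\mathrm{LPF}_\pi[i]=0$ if $\pi(i)=1$ and $\mathrm{LPF}_\pi[i]=\max_{j:\pi(j)<\pi(i)}\mathrm{rlce}(j,i)$ otherwise. -}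

module Defs where

open import Data.Nat using (ℕ; zero; suc; _⊔_)
open import Data.Fin using (Fin; toℕ; _<_; _<?_)
open import Data.Fin.Permutation using (Permutation′; _⟨$⟩ʳ_)
open import Data.List using (List; []; _∷_; drop; filter; map; foldr; allFin)
open import Data.Vec using (Vec; lookup; toList)
open import Relation.Binary.Definitions using (DecidableEquality)
open import Relation.Binary.PropositionalEquality using (_≡_)
open import Relation.Nullary using (yes; no)

-- Conventions: positions are 0-indexed (Fin n); position k here is
-- position k+1 of the paper.  The string S ∈ Σⁿ is a Vec over an alphabet
-- with decidable equality.

lcp : {Σ : Set} → DecidableEquality Σ → List Σ → List Σ → ℕ
lcp _≟_ []       _        = 0
lcp _≟_ (_ ∷ _)  []       = 0
lcp _≟_ (x ∷ xs) (y ∷ ys) with x ≟ y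
... | yes _ = suc (lcp _≟_ xs ys)
... | no  _ = 0

rlce : {Σ : Set} → DecidableEquality Σ → {n : ℕ} → Vec Σ n → Fin n → Fin n → ℕ
rlce _≟_ S i j = lcp _≟_ (drop (toℕ i) (toList S)) (drop (toℕ j) (toList S))

OrderPreserving : {Σ : Set} {n : ℕ} → Vec Σ n → Permutation′ n → Set
OrderPreserving {n = n} S π =
  (i i' j j' : Fin n) → toℕ i' ≡ suc (toℕ i) → toℕ j' ≡ suc (toℕ j) →
  π ⟨$⟩ʳ i < π ⟨$⟩ʳ j →
  lookup S i ≡ lookup S j → lookup S i' ≡ lookup S j' →
  π ⟨$⟩ʳ i' < π ⟨$⟩ʳ j'

maxList : List ℕ → ℕ
maxList = foldr _⊔_ 0

LPF : {Σ : Set} → DecidableEquality Σ → {n : ℕ} → Vec Σ n → Permutation′ n → Fin n → ℕ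
LPF _≟_ {n} S π i with toℕ (π ⟨$⟩ʳ i)
... | zero  = 0
... | suc _ = maxList (map (λ j → rlce _≟_ S j i)
                           (filter (λ j → (π ⟨$⟩ʳ j) <? (π ⟨$⟩ʳ i)) (allFin n)))

{-# OPTIONS --safe #-}
-- If LPF_π[p] = ℓ ≥ 2 is witnessed by some j ranked before p, then S[j] = S[p]
-- and S[j+1] = S[p+1], so order preservation ranks j+1 before p+1, and
-- rlce(j+1, p+1) = ℓ - 1.  Hence i + LPF_π[i] never decreases from one
-- position to the next.
module Submission where

open import Defs
open import Data.Nat using (ℕ; zero; suc; _+_; _∸_; _≤_; _≤?_; z≤n)
open import Data.Nat.Properties
  using ( ≤-refl; ≤-trans; ≤-reflexive; ⊔-sel; m≤n⇒m≤n⊔o; m≤n⇒m≤o⊔n; m≤n+m∸n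
        ; +-monoʳ-≤; +-suc; module ≤-Reasoning)
open import Data.Fin using (Fin; toℕ; inject₁; _<_; _<?_)
open import Data.Fin.Induction using (<-weakInduction-startingFrom)
open import Data.Fin.Properties using (toℕ-inject₁)
open import Data.Fin.Permutation using (Permutation′; _⟨$⟩ʳ_)
open import Data.Vec using (Vec; []; _∷_; lookup; toList)
open import Data.List using (List; []; _∷_; drop; filter; map; allFin)
open import Data.List.Properties using (filter-none; foldr-preservesᵒ)
open import Data.List.Membership.Propositional using (_∈_)
open import Data.List.Membership.Propositional.Properties
  using (foldr-selective; ∈-map⁺; ∈-map⁻; ∈-filter⁺; ∈-filter⁻; ∈-allFin)
open import Data.List.Relation.Unary.All using (universal)
import Data.List.Relation.Unary.Any as Any
open import Data.Product using (_×_; _,_; ∃; proj₁)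
open import Data.Sum using (inj₁; inj₂; [_,_])
open import Relation.Binary.Definitions using (DecidableEquality)
open import Relation.Binary.PropositionalEquality
  using (_≡_; refl; sym; trans; cong; cong₂; subst)
open import Relation.Nullary using (yes; no)

≤-maxList : ∀ {x xs} → x ∈ xs → x ≤ maxList xs
≤-maxList x∈xs =
  foldr-preservesᵒ (λ a b → [ m≤n⇒m≤n⊔o b , m≤n⇒m≤o⊔n a ]) 0 _
    (inj₂ (Any.map ≤-reflexive x∈xs))

maxList-suc-∈ : ∀ {xs k} → maxList xs ≡ suc k → suc k ∈ xs
maxList-suc-∈ {xs} max≡1+k with foldr-selective ⊔-sel 0 xs
... | inj₁ max≡0  with () ← trans (sym max≡1+k) max≡0
... | inj₂ max∈xs = subst (_∈ xs) max≡1+k max∈xs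

lcp-suc⁻ : ∀ {A : Set} (_≟_ : DecidableEquality A) {x y xs ys k} →
  lcp _≟_ (x ∷ xs) (y ∷ ys) ≡ suc k → x ≡ y × lcp _≟_ xs ys ≡ k
lcp-suc⁻ _≟_ {x} {y} eq with x ≟ y
lcp-suc⁻ _≟_ refl | yes x≡y = x≡y , refl
lcp-suc⁻ _≟_ ()   | no _

drop-toList : ∀ {A : Set} {n} (S : Vec A n) (a : Fin n) →
  drop (toℕ a) (toList S) ≡ lookup S a ∷ drop (suc (toℕ a)) (toList S)
drop-toList (x ∷ S) Fin.zero    = refl
drop-toList (x ∷ S) (Fin.suc a) = drop-toList S a

lcp-drop-toList⇒index : ∀ {A : Set} (_≟_ : DecidableEquality A) {n} (S : Vec A n) m {ys k} →
  lcp _≟_ (drop m (toList S)) ys ≡ suc k → ∃ λ (a : Fin n) → toℕ a ≡ m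
lcp-drop-toList⇒index _≟_ []      zero    ()
lcp-drop-toList⇒index _≟_ []      (suc m) ()
lcp-drop-toList⇒index _≟_ (x ∷ S) zero    _   = Fin.zero , refl
lcp-drop-toList⇒index _≟_ (x ∷ S) (suc m) eq
  with a , toℕa≡m ← lcp-drop-toList⇒index _≟_ S m eq = Fin.suc a , cong suc toℕa≡m

≤-steps⇒monotone : ∀ {n} (f : Fin n → ℕ) →
  (∀ p i → toℕ i ≡ suc (toℕ p) → f p ≤ f i) →
  ∀ i j → toℕ i ≤ toℕ j → f i ≤ f j
≤-steps⇒monotone {zero}  f step () j i≤j
≤-steps⇒monotone {suc n} f step i  j i≤j =
  <-weakInduction-startingFrom (λ j → f i ≤ f j) ≤-refl
    (λ j fi≤fj → ≤-trans fi≤fj (step (inject₁ j) (Fin.suc j) (cong suc (sym (toℕ-inject₁ j)))))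
    i≤j

module _ {Σ : Set} (_≟_ : DecidableEquality Σ) {n : ℕ} (S : Vec Σ n) where

  rlce-suc⁻ : ∀ {j i k} → rlce _≟_ S j i ≡ suc k →
    lookup S j ≡ lookup S i ×
    lcp _≟_ (drop (suc (toℕ j)) (toList S)) (drop (suc (toℕ i)) (toList S)) ≡ k
  rlce-suc⁻ {j} {i} {k} eq = lcp-suc⁻ _≟_
    (subst (λ xs → xs ≡ suc k) (cong₂ (lcp _≟_) (drop-toList S j) (drop-toList S i)) eq)

  rlce-successor : ∀ {j i i′ k} → toℕ i′ ≡ suc (toℕ i) → rlce _≟_ S j i ≡ suc (suc k) →
    ∃ λ j′ → toℕ j′ ≡ suc (toℕ j) × rlce _≟_ S j′ i′ ≡ suc k
  rlce-successor {j} i′≡1+i eq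
    with _ , rest ← rlce-suc⁻ eq
    with j′ , j′≡1+j ← lcp-drop-toList⇒index _≟_ S (suc (toℕ j)) rest
    = j′ , j′≡1+j
    , trans (cong₂ (λ a b → lcp _≟_ (drop a (toList S)) (drop b (toList S))) j′≡1+j i′≡1+i) rest

  module _ (π : Permutation′ n) where

    rankedBefore : Fin n → List (Fin n)
    rankedBefore i = filter (λ j → π ⟨$⟩ʳ j <? π ⟨$⟩ʳ i) (allFin n)

    -- `with` also abstracts the rank of i inside the filter on the right, where
    -- Fin's _<?_ has unfolded to suc (toℕ _) ≤? _.
    LPF≡maxList : ∀ i → LPF _≟_ S π i ≡ maxList (map (λ j → rlce _≟_ S j i) (rankedBefore i))
    LPF≡maxList i with toℕ (π ⟨$⟩ʳ i) in rank
    ... | zero  = sym (cong (λ js → maxList (map (λ j → rlce _≟_ S j i) js))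
                    (filter-none (λ j → suc (toℕ (π ⟨$⟩ʳ j)) ≤? 0) (universal (λ _ ()) (allFin n))))
    ... | suc _ = cong (λ r → maxList (map (λ j → rlce _≟_ S j i)
                      (filter (λ j → suc (toℕ (π ⟨$⟩ʳ j)) ≤? r) (allFin n)))) rank

    rlce≤LPF : ∀ {j i} → π ⟨$⟩ʳ j < π ⟨$⟩ʳ i → rlce _≟_ S j i ≤ LPF _≟_ S π i
    rlce≤LPF {j} {i} j<i = subst (rlce _≟_ S j i ≤_) (sym (LPF≡maxList i))
      (≤-maxList (∈-map⁺ (λ j → rlce _≟_ S j i)
        (∈-filter⁺ (λ j → π ⟨$⟩ʳ j <? π ⟨$⟩ʳ i) (∈-allFin j) j<i)))

    LPF-witness : ∀ {i k} → LPF _≟_ S π i ≡ suc k →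
      ∃ λ j → π ⟨$⟩ʳ j < π ⟨$⟩ʳ i × rlce _≟_ S j i ≡ suc k
    LPF-witness {i} LPF≡1+k
      with j , j∈ , 1+k≡rlce ← ∈-map⁻ (λ j → rlce _≟_ S j i)
                                 (maxList-suc-∈ (trans (sym (LPF≡maxList i)) LPF≡1+k))
      with _ , j<i ← ∈-filter⁻ (λ j → π ⟨$⟩ʳ j <? π ⟨$⟩ʳ i) {xs = allFin n} j∈
      = j , j<i , sym 1+k≡rlce

    module _ (order-preserving : OrderPreserving S π) where

      LPF-pred∸1≤LPF : ∀ p i → toℕ i ≡ suc (toℕ p) → LPF _≟_ S π p ∸ 1 ≤ LPF _≟_ S π i
      LPF-pred∸1≤LPF p i i≡1+p with LPF _≟_ S π p in LPF≡
      ... | zero        = z≤n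
      ... | suc zero    = z≤n
      ... | suc (suc k)
        with j , j<p , rlce[j,p] ← LPF-witness LPF≡
        with j′ , j′≡1+j , rlce[j′,i] ← rlce-successor i≡1+p rlce[j,p]
        = subst (_≤ LPF _≟_ S π i) rlce[j′,i] (rlce≤LPF j′<i)
        where
        j′<i : π ⟨$⟩ʳ j′ < π ⟨$⟩ʳ i
        j′<i = order-preserving j j′ p i j′≡1+j i≡1+p j<p
                 (proj₁ (rlce-suc⁻ rlce[j,p])) (proj₁ (rlce-suc⁻ rlce[j′,i]))

      +LPF-step : ∀ p i → toℕ i ≡ suc (toℕ p) →
        toℕ p + LPF _≟_ S π p ≤ toℕ i + LPF _≟_ S π i
      +LPF-step p i i≡1+p = begin
        toℕ p + LPF _≟_ S π p             ≤⟨ +-monoʳ-≤ (toℕ p) (m≤n+m∸n (LPF _≟_ S π p) 1) ⟩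
        toℕ p + suc (LPF _≟_ S π p ∸ 1)   ≡⟨ +-suc (toℕ p) _ ⟩
        suc (toℕ p) + (LPF _≟_ S π p ∸ 1) ≤⟨ +-monoʳ-≤ (suc (toℕ p)) (LPF-pred∸1≤LPF p i i≡1+p) ⟩
        suc (toℕ p) + LPF _≟_ S π i       ≡⟨ cong (_+ LPF _≟_ S π i) (sym i≡1+p) ⟩
        toℕ i + LPF _≟_ S π i             ∎
        where open ≤-Reasoning

lemma11 : {Σ : Set} (_≟_ : DecidableEquality Σ) (n : ℕ) (S : Vec Σ n) (π : Permutation′ n) →
    OrderPreserving S π →
    ((i' i : Fin n) → toℕ i ≡ suc (toℕ i') → LPF _≟_ S π i' ∸ 1 ≤ LPF _≟_ S π i)
    × ((i j : Fin n) → toℕ i ≤ toℕ j → toℕ i + LPF _≟_ S π i ≤ toℕ j + LPF _≟_ S π j)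
lemma11 _≟_ n S π order-preserving =
    LPF-pred∸1≤LPF _≟_ S π order-preserving
  , ≤-steps⇒monotone (λ i → toℕ i + LPF _≟_ S π i) (+LPF-step _≟_ S π order-preserving)
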